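{- Let $q\geq 3$ be a prime power and $d\leq e$ positive integers. For $0\leq i,j\leq d$ let $$B_j(i)=\sum_{h=0}^{j}(-1)^{j-h}q^{eh+\binom{j-h}{2}}{d-h \brack d-j}_q{d-i \brack h}_q.$$ Then for all $0\leq i\leq d-1$ and $1\leq j\leq d$, $|B_j(i)|>|B_j(i+1)|$.
   Context: For integers $N\geq 0$ and $k$, ${N \brack k}_q=\prod_{t=1}^{k}\frac{q^{N-k+t}-1}{q^t-1}$ if $0\leq k\leq N$, and $0$ if $k<0$ or $k>N$. The $B_j(i)$ are the eigenvalues of the bilinear forms graph $H_q(d,e,j)$ ($d\times e$ matrices over $\mathbb{F}_q$, adjacent iff their difference has rank $j$). -}

module Defs where

open import Data.Nat using (ℕ; zero; suc; _+_; _*_; _∸_; _^_; _≤_; _≤?_)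
open import Data.Nat.DivMod using (_/_)
open import Data.Nat.Primality using (Prime)
open import Data.Nat.Combinatorics using (_C_)
open import Data.Integer as ℤ using (ℤ; +_)
open import Data.Product using (∃; _×_)
open import Relation.Binary.PropositionalEquality using (_≡_)
open import Relation.Nullary using (yes; no)

IsPrimePower : ℕ → Set
IsPrimePower q = ∃ λ p → ∃ λ m → Prime p × 1 ≤ m × q ≡ p ^ m

prod1 : ℕ → (ℕ → ℕ) → ℕ
prod1 zero    f = 1
prod1 (suc k) f = prod1 k f * f (suc k)

-- total natural division (division by 0 returns 0; never used when q ≥ 2)
divℕ : ℕ → ℕ → ℕ
divℕ m zero    = 0
divℕ m (suc n) = m / suc n

-- Gaussian binomial [N k]_q = ∏_{t=1}^k (q^{N-k+t} - 1) / (q^t - 1) for 0 ≤ k ≤ N, else 0.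
-- The quotient of the two products is exact (an integer) for q ≥ 2.
gauss : ℕ → ℕ → ℕ → ℕ
gauss q N k with k ≤? N
... | yes _ = divℕ (prod1 k (λ t → q ^ (N ∸ k + t) ∸ 1)) (prod1 k (λ t → q ^ t ∸ 1))
... | no  _ = 0

sgn : ℕ → ℤ
sgn zero    = + 1
sgn (suc n) = ℤ.- sgn n

sumTo : ℕ → (ℕ → ℤ) → ℤ
sumTo zero    f = f 0
sumTo (suc j) f = sumTo j f ℤ.+ f (suc j)

B : (q d e j i : ℕ) → ℤ
B q d e j i = sumTo j (λ h →
  sgn (j ∸ h) ℤ.* + (q ^ (e * h + (j ∸ h) C 2))
    ℤ.* + gauss q (d ∸ h) (d ∸ j) ℤ.* + gauss q (d ∸ i) h)

module Submission where

-- Write n = d − i and K(d,e,j,n) = B_j(i).  The q-Pascal rule gives the recurrence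
--   K(d+1,e+1,j+1,n+1) = K(d+1,e+1,j+1,n) + q^(n+e+1) K(d,e,j,n),
-- with K(d,e,j,0) = (−1)^j q^C(j,2) [d, d−j] and K(d,e,0,n) = 1.  By induction on n,
-- K(d,e,j,n) is nonzero with sign (−1)^(j−n) (positive for n ≥ j) and, for n ≤ j,
--   2 |K(d+1,e+1,j+1,n)| < q^(n+e+1) |K(d,e,j,n)|;
-- at n = 0 this is (q^(j+1) − 1)[d+1, d−j] = (q^(d+1) − 1)[d, d−j] together with q ≥ 3.
-- For n ≤ j the two terms of the recurrence have opposite signs, so the absolute value
-- of the left side is q^(n+e+1)|K(d,e,j,n)| − |K(d+1,e+1,j+1,n)| > |K(d+1,e+1,j+1,n)|
-- by the domination; for n > j both terms are positive and the growth is immediate.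

open import Defs
open import Data.Nat using (ℕ; zero; suc; z<s; _+_; _*_; _∸_; _^_; _≤_; _<_; _>_; _≤?_; z≤n; s≤s; NonZero; >-nonZero)
open import Data.Nat.Properties
open import Data.Nat.DivMod using (m*n/n≡m)
open import Data.Nat.Tactic.RingSolver using (solve-∀)
open import Data.Nat.Combinatorics using (_C_; nC1≡n; nCk+nC[k+1]≡[n+1]C[k+1])
open import Data.Integer as ℤ using (ℤ; +_; ∣_∣)
import Data.Integer.Properties as ℤₚ
import Data.Integer.Tactic.RingSolver as ℤ-Solver
open import Relation.Binary.PropositionalEquality
open import Relation.Nullary using (yes; no; contradiction)

∸-exchange : ∀ {a b c d} → a + b ≡ c + d → a ∸ d ≡ c ∸ b
∸-exchange {a} {b} {c} {d} eq = begin
    a ∸ d              ≡⟨ [m+n]∸[m+o]≡n∸o b a d ⟨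
    (b + a) ∸ (b + d)  ≡⟨ cong₂ _∸_ (trans (+-comm b a) eq) (+-comm b d) ⟩
    (c + d) ∸ (d + b)  ≡⟨ cong (_∸ (d + b)) (+-comm c d) ⟩
    (d + c) ∸ (d + b)  ≡⟨ [m+n]∸[m+o]≡n∸o d c b ⟩
    c ∸ b              ∎
  where open ≡-Reasoning

2*m<n⇒m<n∸m : ∀ {m n} → 2 * m < n → m < n ∸ m
2*m<n⇒m<n∸m {m} {n} 2m<n = m+n≤o⇒m≤o∸n (suc m) (subst (_≤ n) (double m) 2m<n)
  where
  double : ∀ m → suc (2 * m) ≡ suc m + m
  double = solve-∀

dominance-base : ∀ {q T X Y V} → 3 ≤ q → 1 ≤ T → 0 < X → q * T * Y + X ≡ Y + V → 2 * (T * Y) < V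
dominance-base {q} {T} {X} {Y} {V} 3≤q 1≤T 0<X absorb = +-cancelˡ-< Y _ _ (begin-strict
    Y + 2 * (T * Y)      ≤⟨ +-monoˡ-≤ (2 * (T * Y)) (m≤n*m Y T {{>-nonZero 1≤T}}) ⟩
    T * Y + 2 * (T * Y)  ≡⟨ triple T Y ⟩
    3 * T * Y            ≤⟨ *-monoˡ-≤ Y (*-monoˡ-≤ T 3≤q) ⟩
    q * T * Y            <⟨ m<m+n (q * T * Y) 0<X ⟩
    q * T * Y + X        ≡⟨ absorb ⟩
    Y + V                ∎)
  where
  open ≤-Reasoning
  triple : ∀ T Y → T * Y + 2 * (T * Y) ≡ 3 * T * Y
  triple = solve-∀

dominance-step : ∀ {q R a b c} → 2 ≤ q → 0 < R → 2 * b < c → 2 * (R * b ∸ a) < q * R * (c ∸ b)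
dominance-step {q} {R} {a} {b} {c} 2≤q 0<R 2b<c = begin-strict
    2 * (R * b ∸ a)          ≤⟨ *-monoʳ-≤ 2 (m∸n≤m (R * b) a) ⟩
    2 * (R * b)              ≤⟨ *-monoˡ-≤ (R * b) 2≤q ⟩
    q * (R * b)              <⟨ m<m+n (q * (R * b)) (*-mono-< (≤-trans (s≤s z≤n) 2≤q) 0<R) ⟩
    q * (R * b) + q * R      ≡⟨ collect q R b ⟩
    q * R * suc b            ≤⟨ *-monoʳ-≤ (q * R) (m+n≤o⇒m≤o∸n (suc b) (≤-trans (≤-reflexive (double b)) 2b<c)) ⟩
    q * R * (c ∸ b)          ∎
  where
  open ≤-Reasoning
  collect : ∀ q R b → q * (R * b) + q * R ≡ q * R * suc b
  collect = solve-∀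
  double : ∀ b → suc b + b ≡ suc (2 * b)
  double = solve-∀

module _ (q : ℕ) where

  qBinom : ℕ → ℕ → ℕ
  qBinom n       zero    = 1
  qBinom zero    (suc k) = 0
  qBinom (suc n) (suc k) = qBinom n k + q ^ suc k * qBinom n (suc k)

  qBinom-zero : ∀ {n k} → n < k → qBinom n k ≡ 0
  qBinom-zero {zero}  {suc k} _         = refl
  qBinom-zero {suc n} {suc k} (s≤s n<k)
    rewrite qBinom-zero n<k | qBinom-zero (m<n⇒m<1+n n<k) = *-zeroʳ (q ^ suc k)

  qBinom-pos : ∀ {n k} → k ≤ n → 0 < qBinom n k
  qBinom-pos {k = zero}     _         = z<s
  qBinom-pos {suc n} {suc k} (s≤s k≤n) = ≤-trans (qBinom-pos k≤n) (m≤m+n _ _)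

  qBinom-diag : ∀ n → qBinom n n ≡ 1
  qBinom-diag zero = refl
  qBinom-diag (suc n) rewrite qBinom-diag n | qBinom-zero (n<1+n n) = cong suc (*-zeroʳ (q ^ suc n))

  qBinom-pascal′ : ∀ n k → q ^ k * qBinom (suc n) (suc k) ≡ q ^ n * qBinom n k + q ^ k * qBinom n (suc k)
  qBinom-pascal′ zero zero = cong suc (trans (+-identityʳ _) (*-zeroʳ (q * 1)))
  qBinom-pascal′ zero (suc k) = cong (q ^ suc k *_) (*-zeroʳ (q ^ suc (suc k)))
  qBinom-pascal′ (suc n) zero = begin
      1 * (1 + q * 1 * (1 + q * 1 * x))  ≡⟨ regroup q x ⟩
      1 + q * (1 * (1 + q * 1 * x))      ≡⟨ cong (λ w → 1 + q * w) (qBinom-pascal′ n zero) ⟩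
      1 + q * (q ^ n * 1 + 1 * x)        ≡⟨ expand q (q ^ n) x ⟩
      q * q ^ n * 1 + 1 * (1 + q * 1 * x) ∎
    where
    open ≡-Reasoning
    x = qBinom n 1
    regroup : ∀ q x → 1 * (1 + q * 1 * (1 + q * 1 * x)) ≡ 1 + q * (1 * (1 + q * 1 * x))
    regroup = solve-∀
    expand : ∀ q N x → 1 + q * (N * 1 + 1 * x) ≡ q * N * 1 + 1 * (1 + q * 1 * x)
    expand = solve-∀
  qBinom-pascal′ (suc n) (suc k) = begin
      q * Q * (X + q * (q * Q) * Y)                      ≡⟨ regroup q Q X Y ⟩
      q * (Q * X) + q * (q * Q) * (q * Q * Y)            ≡⟨ cong₂ (λ u v → q * u + q * (q * Q) * v)
                                                              (qBinom-pascal′ n k) (qBinom-pascal′ n (suc k)) ⟩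
      q * (N * a + Q * b) + q * (q * Q) * (N * b + q * Q * c) ≡⟨ expand q Q N a b c ⟩
      q * N * (a + q * Q * b) + q * Q * (b + q * (q * Q) * c) ∎
    where
    open ≡-Reasoning
    Q = q ^ k
    N = q ^ n
    X = qBinom (suc n) (suc k)
    Y = qBinom (suc n) (suc (suc k))
    a = qBinom n k
    b = qBinom n (suc k)
    c = qBinom n (suc (suc k))
    regroup : ∀ q Q X Y → q * Q * (X + q * (q * Q) * Y) ≡ q * (Q * X) + q * (q * Q) * (q * Q * Y)
    regroup = solve-∀
    expand : ∀ q Q N a b c → q * (N * a + Q * b) + q * (q * Q) * (N * b + q * Q * c)
                           ≡ q * N * (a + q * Q * b) + q * Q * (b + q * (q * Q) * c)
    expand = solve-∀

  qBinom-shift : ∀ a n h → q ^ (a + h) * qBinom (suc n) (suc h)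
                         ≡ q ^ (a + n) * qBinom n h + q ^ (a + h) * qBinom n (suc h)
  qBinom-shift a n h = begin
      q ^ (a + h) * X                  ≡⟨ cong (_* X) (^-distribˡ-+-* q a h) ⟩
      q ^ a * q ^ h * X                ≡⟨ *-assoc (q ^ a) (q ^ h) X ⟩
      q ^ a * (q ^ h * X)              ≡⟨ cong (q ^ a *_) (qBinom-pascal′ n h) ⟩
      q ^ a * (q ^ n * x + q ^ h * y)  ≡⟨ distrib (q ^ a) (q ^ n) (q ^ h) x y ⟩
      q ^ a * q ^ n * x + q ^ a * q ^ h * y
        ≡⟨ cong₂ (λ u v → u * x + v * y) (^-distribˡ-+-* q a n) (^-distribˡ-+-* q a h) ⟨
      q ^ (a + n) * x + q ^ (a + h) * y ∎
    where
    open ≡-Reasoning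
    X = qBinom (suc n) (suc h)
    x = qBinom n h
    y = qBinom n (suc h)
    distrib : ∀ A N H x y → A * (N * x + H * y) ≡ A * N * x + A * H * y
    distrib = solve-∀

  qBinom-absorb : ∀ n k → q ^ suc k * qBinom (suc n) (suc k) + qBinom n k
                        ≡ qBinom (suc n) (suc k) + q ^ suc n * qBinom n k
  qBinom-absorb n k = begin
      q * Q * X + a                  ≡⟨ cong (_+ a) (*-assoc q Q X) ⟩
      q * (Q * X) + a                ≡⟨ cong (λ w → q * w + a) (qBinom-pascal′ n k) ⟩
      q * (N * a + Q * b) + a        ≡⟨ expand q Q N a b ⟩
      (a + q * Q * b) + q * N * a    ∎
    where
    open ≡-Reasoning
    Q = q ^ k
    N = q ^ n
    X = qBinom (suc n) (suc k)
    a = qBinom n k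
    b = qBinom n (suc k)
    expand : ∀ q Q N a b → q * (N * a + Q * b) + a ≡ (a + q * Q * b) + q * N * a
    expand = solve-∀

  qBinom-absorb-∸ : ∀ n k → (q ^ suc n ∸ 1) * qBinom n k ≡ (q ^ suc k ∸ 1) * qBinom (suc n) (suc k)
  qBinom-absorb-∸ n k = begin
      (q ^ suc n ∸ 1) * a            ≡⟨ *-distribʳ-∸ a (q ^ suc n) 1 ⟩
      q ^ suc n * a ∸ 1 * a          ≡⟨ ∸-exchange {q ^ suc n * a} {1 * X} {q ^ suc k * X} {1 * a} (begin
        q ^ suc n * a + 1 * X          ≡⟨ cong (λ w → q ^ suc n * a + w) (*-identityˡ X) ⟩
        q ^ suc n * a + X              ≡⟨ +-comm _ X ⟩
        X + q ^ suc n * a              ≡⟨ qBinom-absorb n k ⟨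
        q ^ suc k * X + a              ≡⟨ cong (λ w → q ^ suc k * X + w) (*-identityˡ a) ⟨
        q ^ suc k * X + 1 * a          ∎) ⟩
      q ^ suc k * X ∸ 1 * X          ≡⟨ *-distribʳ-∸ X (q ^ suc k) 1 ⟨
      (q ^ suc k ∸ 1) * X            ∎
    where
    open ≡-Reasoning
    a = qBinom n k
    X = qBinom (suc n) (suc k)

  qBinom-absorb-scaled : ∀ n k → q ^ suc n * qBinom (suc n) k + q ^ k * qBinom n k
                               ≡ q ^ k * qBinom (suc n) k + q ^ suc n * (q ^ k * qBinom n k)
  qBinom-absorb-scaled n zero = trivial (q ^ suc n)
    where
    trivial : ∀ P → P * 1 + 1 * 1 ≡ 1 * 1 + P * (1 * 1)
    trivial = solve-∀
  qBinom-absorb-scaled n (suc k) = sym (begin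
      q * Q * X + q * N * (q * Q * b)      ≡⟨ cong (_+ q * N * (q * Q * b)) (*-assoc q Q X) ⟩
      q * (Q * X) + q * N * (q * Q * b)    ≡⟨ cong (λ w → q * w + q * N * (q * Q * b)) (qBinom-pascal′ n k) ⟩
      q * (N * a + Q * b) + q * N * (q * Q * b) ≡⟨ expand q Q N a b ⟩
      q * N * (a + q * Q * b) + q * Q * b  ∎)
    where
    open ≡-Reasoning
    Q = q ^ k
    N = q ^ n
    X = qBinom (suc n) (suc k)
    a = qBinom n k
    b = qBinom n (suc k)
    expand : ∀ q Q N a b → q * (N * a + Q * b) + q * N * (q * Q * b) ≡ q * N * (a + q * Q * b) + q * Q * b
    expand = solve-∀

  qBinom-absorb′ : ∀ {{_ : NonZero q}} {n j} → j ≤ n →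
                   q ^ suc j * qBinom (suc n) (n ∸ j) + qBinom n (n ∸ j)
                 ≡ qBinom (suc n) (n ∸ j) + q ^ suc n * qBinom n (n ∸ j)
  qBinom-absorb′ {n} {j} j≤n = *-cancelˡ-≡ _ _ (q ^ k) {{m^n≢0 q k}} (begin
      q ^ k * (q ^ suc j * Y + X)          ≡⟨ distrib (q ^ k) (q ^ suc j) Y X ⟩
      q ^ k * q ^ suc j * Y + q ^ k * X    ≡⟨ cong (λ w → w * Y + q ^ k * X) exponent ⟩
      q ^ suc n * Y + q ^ k * X            ≡⟨ qBinom-absorb-scaled n k ⟩
      q ^ k * Y + q ^ suc n * (q ^ k * X)  ≡⟨ collect (q ^ k) (q ^ suc n) Y X ⟩
      q ^ k * (Y + q ^ suc n * X)          ∎)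
    where
    open ≡-Reasoning
    k = n ∸ j
    X = qBinom n k
    Y = qBinom (suc n) k
    exponent : q ^ k * q ^ suc j ≡ q ^ suc n
    exponent = trans (sym (^-distribˡ-+-* q k (suc j))) (cong (q ^_) (trans (+-suc k j) (cong suc (m∸n+n≡m j≤n))))
    distrib : ∀ K T Y X → K * (T * Y + X) ≡ K * T * Y + K * X
    distrib = solve-∀
    collect : ∀ K P Y X → K * Y + P * (K * X) ≡ K * (Y + P * X)
    collect = solve-∀

  prod1-qBinom : ∀ k r → prod1 k (λ t → q ^ (r + t) ∸ 1) ≡ qBinom (k + r) k * prod1 k (λ t → q ^ t ∸ 1)
  prod1-qBinom zero    r = refl
  prod1-qBinom (suc k) r = begin
      prod1 k (λ t → q ^ (r + t) ∸ 1) * (q ^ (r + suc k) ∸ 1)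
        ≡⟨ cong₂ _*_ (prod1-qBinom k r) (cong (λ w → q ^ w ∸ 1) (trans (+-suc r k) (cong suc (+-comm r k)))) ⟩
      qBinom (k + r) k * D * (q ^ suc (k + r) ∸ 1)
        ≡⟨ rotate (qBinom (k + r) k) D (q ^ suc (k + r) ∸ 1) ⟩
      D * ((q ^ suc (k + r) ∸ 1) * qBinom (k + r) k)
        ≡⟨ cong (D *_) (qBinom-absorb-∸ (k + r) k) ⟩
      D * ((q ^ suc k ∸ 1) * qBinom (suc (k + r)) (suc k))
        ≡⟨ rotate′ D (q ^ suc k ∸ 1) (qBinom (suc (k + r)) (suc k)) ⟩
      qBinom (suc (k + r)) (suc k) * (D * (q ^ suc k ∸ 1))
        ∎
    where
    open ≡-Reasoning
    D = prod1 k (λ t → q ^ t ∸ 1)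
    rotate : ∀ x D E → x * D * E ≡ D * (E * x)
    rotate = solve-∀
    rotate′ : ∀ D E y → D * (E * y) ≡ y * (D * E)
    rotate′ = solve-∀

  gauss≡qBinom : 1 < q → ∀ N k → gauss q N k ≡ qBinom N k
  gauss≡qBinom 1<q N k with k ≤? N
  ... | no  k≰N = sym (qBinom-zero (≰⇒> k≰N))
  ... | yes k≤N = begin
      divℕ (prod1 k (λ t → q ^ (N ∸ k + t) ∸ 1)) D  ≡⟨ cong (λ w → divℕ w D) (prod1-qBinom k (N ∸ k)) ⟩
      divℕ (qBinom (k + (N ∸ k)) k * D) D         ≡⟨ divℕ-cancel (qBinom (k + (N ∸ k)) k) (prod1-pos k) ⟩
      qBinom (k + (N ∸ k)) k                      ≡⟨ cong (λ n → qBinom n k) (m+[n∸m]≡n k≤N) ⟩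
      qBinom N k                                  ∎
    where
    open ≡-Reasoning
    D = prod1 k (λ t → q ^ t ∸ 1)
    divℕ-cancel : ∀ a {D} → 0 < D → divℕ (a * D) D ≡ a
    divℕ-cancel a {suc D} _ = m*n/n≡m a (suc D)
    prod1-pos : ∀ k → 0 < prod1 k (λ t → q ^ t ∸ 1)
    prod1-pos zero    = z<s
    prod1-pos (suc k) = *-mono-< (prod1-pos k) (m<n⇒0<n∸m (^-monoʳ-< q 1<q (z<s {k})))

sumTo-cong : ∀ j {f g : ℕ → ℤ} → (∀ h → f h ≡ g h) → sumTo j f ≡ sumTo j g
sumTo-cong zero    f≗g = f≗g 0
sumTo-cong (suc j) f≗g = cong₂ ℤ._+_ (sumTo-cong j f≗g) (f≗g (suc j))

sumTo-head : ∀ j (f : ℕ → ℤ) → (∀ h → f (suc h) ≡ + 0) → sumTo j f ≡ f 0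
sumTo-head zero    f tail≡0 = refl
sumTo-head (suc j) f tail≡0 = trans (cong₂ ℤ._+_ (sumTo-head j f tail≡0) (tail≡0 j)) (ℤₚ.+-identityʳ (f 0))

sumTo-step : ∀ j c {f g f′ : ℕ → ℤ} → f′ 0 ≡ f 0 → (∀ h → f′ (suc h) ≡ f (suc h) ℤ.+ c ℤ.* g h) →
             sumTo (suc j) f′ ≡ sumTo (suc j) f ℤ.+ c ℤ.* sumTo j g
sumTo-step zero c {f} {g} {f′} head tail = begin
    f′ 0 ℤ.+ f′ 1 ≡⟨ cong₂ ℤ._+_ head (tail 0) ⟩
    f 0 ℤ.+ (f 1 ℤ.+ c ℤ.* g 0) ≡⟨ ℤₚ.+-assoc (f 0) (f 1) (c ℤ.* g 0) ⟨
    f 0 ℤ.+ f 1 ℤ.+ c ℤ.* g 0 ∎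
  where open ≡-Reasoning
sumTo-step (suc j) c {f} {g} {f′} head tail = begin
    sumTo (suc j) f′ ℤ.+ f′ (suc (suc j))
      ≡⟨ cong₂ ℤ._+_ (sumTo-step j c head tail) (tail (suc j)) ⟩
    (sumTo (suc j) f ℤ.+ c ℤ.* sumTo j g) ℤ.+ (f (suc (suc j)) ℤ.+ c ℤ.* g (suc j))
      ≡⟨ regroup (sumTo (suc j) f) (sumTo j g) (f (suc (suc j))) (g (suc j)) c ⟩
    (sumTo (suc j) f ℤ.+ f (suc (suc j))) ℤ.+ c ℤ.* (sumTo j g ℤ.+ g (suc j)) ∎
  where
  open ≡-Reasoning
  regroup : ∀ F G x y c → (F ℤ.+ c ℤ.* G) ℤ.+ (x ℤ.+ c ℤ.* y) ≡ (F ℤ.+ x) ℤ.+ c ℤ.* (G ℤ.+ y)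
  regroup = ℤ-Solver.solve-∀

∣sgn*+∣ : ∀ k n → ∣ sgn k ℤ.* + n ∣ ≡ n
∣sgn*+∣ zero    n = cong ∣_∣ (ℤₚ.*-identityˡ (+ n))
∣sgn*+∣ (suc k) n = begin
    ∣ ℤ.- sgn k ℤ.* + n ∣    ≡⟨ cong ∣_∣ (ℤₚ.neg-distribˡ-* (sgn k) (+ n)) ⟨
    ∣ ℤ.- (sgn k ℤ.* + n) ∣  ≡⟨ ℤₚ.∣-i∣≡∣i∣ (sgn k ℤ.* + n) ⟩
    ∣ sgn k ℤ.* + n ∣        ≡⟨ ∣sgn*+∣ k n ⟩
    n                        ∎
  where open ≡-Reasoning

sgn-suc-cancel : ∀ k {a b} → a ≤ b → sgn (suc k) ℤ.* + a ℤ.+ sgn k ℤ.* + b ≡ sgn k ℤ.* + (b ∸ a)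
sgn-suc-cancel k {a} {b} a≤b = begin
    ℤ.- s ℤ.* + a ℤ.+ s ℤ.* + b  ≡⟨ factor s (+ a) (+ b) ⟩
    s ℤ.* (+ b ℤ.- + a)          ≡⟨ cong (s ℤ.*_) (trans (ℤₚ.m-n≡m⊖n b a) (ℤₚ.⊖-≥ a≤b)) ⟩
    s ℤ.* + (b ∸ a)              ∎
  where
  open ≡-Reasoning
  s = sgn k
  factor : ∀ s a b → ℤ.- s ℤ.* a ℤ.+ s ℤ.* b ≡ s ℤ.* (b ℤ.- a)
  factor = ℤ-Solver.solve-∀

K-term : (q d e j n h : ℕ) → ℤ
K-term q d e j n h = sgn (j ∸ h) ℤ.* + (q ^ (e * h + (j ∸ h) C 2)) ℤ.* + qBinom q (d ∸ h) (d ∸ j) ℤ.* + qBinom q n h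

K : (q d e j n : ℕ) → ℤ
K q d e j n = sumTo j (K-term q d e j n)

B≡K : ∀ {q} → 1 < q → ∀ d e j i → B q d e j i ≡ K q d e j (d ∸ i)
B≡K {q} 1<q d e j i = sumTo-cong j λ h →
  cong₂ (λ x y → sgn (j ∸ h) ℤ.* + (q ^ (e * h + (j ∸ h) C 2)) ℤ.* + x ℤ.* + y)
        (gauss≡qBinom q 1<q (d ∸ h) (d ∸ j)) (gauss≡qBinom q 1<q (d ∸ i) h)

K-coefficient-shift : ∀ q e n h c →
  q ^ (suc e * suc h + c) * qBinom q (suc n) (suc h)
    ≡ q ^ (n + suc e) * (q ^ (e * h + c) * qBinom q n h) + q ^ (suc e * suc h + c) * qBinom q n (suc h)
K-coefficient-shift q e n h c = begin
    q ^ (suc e * suc h + c) * Y′          ≡⟨ cong (λ m → q ^ m * Y′) exponent-h ⟩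
    q ^ (a + h) * Y′                      ≡⟨ qBinom-shift q a n h ⟩
    q ^ (a + n) * y + q ^ (a + h) * Y     ≡⟨ cong₂ (λ u v → q ^ u * y + q ^ v * Y) exponent-n exponent-h ⟨
    q ^ (n + suc e + (e * h + c)) * y + q ^ (suc e * suc h + c) * Y
      ≡⟨ cong (λ w → w * y + q ^ (suc e * suc h + c) * Y) (^-distribˡ-+-* q (n + suc e) (e * h + c)) ⟩
    q ^ (n + suc e) * q ^ (e * h + c) * y + q ^ (suc e * suc h + c) * Y
      ≡⟨ cong (_+ q ^ (suc e * suc h + c) * Y) (*-assoc (q ^ (n + suc e)) (q ^ (e * h + c)) y) ⟩
    q ^ (n + suc e) * (q ^ (e * h + c) * y) + q ^ (suc e * suc h + c) * Y ∎
  where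
  open ≡-Reasoning
  a = suc e + (e * h + c)
  Y′ = qBinom q (suc n) (suc h)
  Y = qBinom q n (suc h)
  y = qBinom q n h
  exponent-h : suc e * suc h + c ≡ a + h
  exponent-h = rearrange e h c
    where
    rearrange : ∀ e h c → suc e * suc h + c ≡ suc e + (e * h + c) + h
    rearrange = solve-∀
  exponent-n : n + suc e + (e * h + c) ≡ a + n
  exponent-n = rearrange n e h c
    where
    rearrange : ∀ n e h c → n + suc e + (e * h + c) ≡ suc e + (e * h + c) + n
    rearrange = solve-∀

K-term-suc : ∀ q d e j n h → K-term q (suc d) (suc e) (suc j) (suc n) (suc h)
                           ≡ K-term q (suc d) (suc e) (suc j) n (suc h) ℤ.+ + (q ^ (n + suc e)) ℤ.* K-term q d e j n h
K-term-suc q d e j n h = begin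
    s ℤ.* + P ℤ.* x ℤ.* + Y′                       ≡⟨ pull s (+ P) x (+ Y′) ⟩
    s ℤ.* x ℤ.* (+ P ℤ.* + Y′)                     ≡⟨ cong (s ℤ.* x ℤ.*_) (ℤₚ.pos-* P Y′) ⟨
    s ℤ.* x ℤ.* + (P * Y′)                         ≡⟨ cong (λ w → s ℤ.* x ℤ.* + w) (K-coefficient-shift q e n h c) ⟩
    s ℤ.* x ℤ.* + (Q * (P₀ * y) + P * Y)           ≡⟨ cong (s ℤ.* x ℤ.*_) lift ⟩
    s ℤ.* x ℤ.* (+ Q ℤ.* (+ P₀ ℤ.* + y) ℤ.+ + P ℤ.* + Y)
      ≡⟨ spread s x (+ Q) (+ P₀) (+ y) (+ P) (+ Y) ⟩
    s ℤ.* + P ℤ.* x ℤ.* + Y ℤ.+ + Q ℤ.* (s ℤ.* + P₀ ℤ.* x ℤ.* + y) ∎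
  where
  open ≡-Reasoning
  c = (j ∸ h) C 2
  s = sgn (j ∸ h)
  x = + qBinom q (d ∸ h) (d ∸ j)
  Q = q ^ (n + suc e)
  P = q ^ (suc e * suc h + c)
  P₀ = q ^ (e * h + c)
  Y′ = qBinom q (suc n) (suc h)
  Y = qBinom q n (suc h)
  y = qBinom q n h
  lift : + (Q * (P₀ * y) + P * Y) ≡ + Q ℤ.* (+ P₀ ℤ.* + y) ℤ.+ + P ℤ.* + Y
  lift = trans (ℤₚ.pos-+ (Q * (P₀ * y)) (P * Y))
               (cong₂ ℤ._+_ (trans (ℤₚ.pos-* Q (P₀ * y)) (cong (+ Q ℤ.*_) (ℤₚ.pos-* P₀ y))) (ℤₚ.pos-* P Y))
  pull : ∀ s P x Y → s ℤ.* P ℤ.* x ℤ.* Y ≡ s ℤ.* x ℤ.* (P ℤ.* Y)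
  pull = ℤ-Solver.solve-∀
  spread : ∀ s x Q P₀ y P Y → s ℤ.* x ℤ.* (Q ℤ.* (P₀ ℤ.* y) ℤ.+ P ℤ.* Y)
                            ≡ s ℤ.* P ℤ.* x ℤ.* Y ℤ.+ Q ℤ.* (s ℤ.* P₀ ℤ.* x ℤ.* y)
  spread = ℤ-Solver.solve-∀

K-suc : ∀ q d e j n → K q (suc d) (suc e) (suc j) (suc n)
                    ≡ K q (suc d) (suc e) (suc j) n ℤ.+ + (q ^ (n + suc e)) ℤ.* K q d e j n
K-suc q d e j n = sumTo-step j (+ (q ^ (n + suc e))) refl (K-term-suc q d e j n)

K-zero-rank : ∀ q d e n → K q d e 0 n ≡ + 1
K-zero-rank q d e n rewrite *-zeroʳ e | qBinom-diag q d = refl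

K-at-zero : ∀ q d e j → K q d e j 0 ≡ sgn j ℤ.* + (q ^ (j C 2) * qBinom q d (d ∸ j))
K-at-zero q d e j = begin
    K q d e j 0
      ≡⟨ sumTo-head j (K-term q d e j 0) (λ h → ℤₚ.*-zeroʳ (sgn (j ∸ suc h) ℤ.* + (q ^ (e * suc h + (j ∸ suc h) C 2))
                                                           ℤ.* + qBinom q (d ∸ suc h) (d ∸ j))) ⟩
    sgn j ℤ.* + (q ^ (e * 0 + j C 2)) ℤ.* x ℤ.* + 1  ≡⟨ ℤₚ.*-identityʳ _ ⟩
    sgn j ℤ.* + (q ^ (e * 0 + j C 2)) ℤ.* x          ≡⟨ cong (λ m → sgn j ℤ.* + (q ^ (m + j C 2)) ℤ.* x) (*-zeroʳ e) ⟩
    sgn j ℤ.* + (q ^ (j C 2)) ℤ.* x                  ≡⟨ ℤₚ.*-assoc (sgn j) _ x ⟩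
    sgn j ℤ.* (+ (q ^ (j C 2)) ℤ.* x)                ≡⟨ cong (sgn j ℤ.*_) (ℤₚ.pos-* (q ^ (j C 2)) _) ⟨
    sgn j ℤ.* + (q ^ (j C 2) * qBinom q d (d ∸ j))   ∎
  where
  open ≡-Reasoning
  x = + qBinom q d (d ∸ j)

sgn-combine-opposite : ∀ k Q {x y a b} → x ≡ sgn (suc k) ℤ.* + a → y ≡ sgn k ℤ.* + b → a ≤ Q * b →
                       x ℤ.+ + Q ℤ.* y ≡ sgn k ℤ.* + (Q * b ∸ a)
sgn-combine-opposite k Q {a = a} {b} refl refl a≤Qb = begin
    sgn (suc k) ℤ.* + a ℤ.+ + Q ℤ.* (sgn k ℤ.* + b)  ≡⟨ cong (λ w → sgn (suc k) ℤ.* + a ℤ.+ w) (commute (+ Q) (sgn k) (+ b)) ⟩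
    sgn (suc k) ℤ.* + a ℤ.+ sgn k ℤ.* (+ Q ℤ.* + b)  ≡⟨ cong (λ w → sgn (suc k) ℤ.* + a ℤ.+ sgn k ℤ.* w) (ℤₚ.pos-* Q b) ⟨
    sgn (suc k) ℤ.* + a ℤ.+ sgn k ℤ.* + (Q * b)      ≡⟨ sgn-suc-cancel k a≤Qb ⟩
    sgn k ℤ.* + (Q * b ∸ a)                          ∎
  where
  open ≡-Reasoning
  commute : ∀ Q s b → Q ℤ.* (s ℤ.* b) ≡ s ℤ.* (Q ℤ.* b)
  commute = ℤ-Solver.solve-∀

sgn-combine-same : ∀ k Q {x y a b} → x ≡ sgn k ℤ.* + a → y ≡ sgn k ℤ.* + b →
                   x ℤ.+ + Q ℤ.* y ≡ sgn k ℤ.* + (a + Q * b)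
sgn-combine-same k Q {a = a} {b} refl refl = begin
    sgn k ℤ.* + a ℤ.+ + Q ℤ.* (sgn k ℤ.* + b)  ≡⟨ factor (sgn k) (+ a) (+ Q) (+ b) ⟩
    sgn k ℤ.* (+ a ℤ.+ + Q ℤ.* + b)            ≡⟨ cong (λ w → sgn k ℤ.* (+ a ℤ.+ w)) (ℤₚ.pos-* Q b) ⟨
    sgn k ℤ.* (+ a ℤ.+ + (Q * b))              ≡⟨ cong (sgn k ℤ.*_) (ℤₚ.pos-+ a (Q * b)) ⟨
    sgn k ℤ.* + (a + Q * b)                    ∎
  where
  open ≡-Reasoning
  factor : ∀ s a Q b → s ℤ.* a ℤ.+ Q ℤ.* (s ℤ.* b) ≡ s ℤ.* (a ℤ.+ Q ℤ.* b)
  factor = ℤ-Solver.solve-∀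

signed-magnitude : ∀ k n {x} → x ≡ sgn k ℤ.* + n → x ≡ sgn k ℤ.* + ∣ x ∣
signed-magnitude k n x≡ = trans x≡ (cong (λ w → sgn k ℤ.* + w) (sym (trans (cong ∣_∣ x≡) (∣sgn*+∣ k n))))

∣∣-signed : ∀ k n {x} → x ≡ sgn k ℤ.* + n → ∣ x ∣ ≡ n
∣∣-signed k n x≡ = trans (cong ∣_∣ x≡) (∣sgn*+∣ k n)

module _ {q : ℕ} (3≤q : 3 ≤ q) where

  private
    instance
      q-nonZero : NonZero q
      q-nonZero = >-nonZero (≤-trans (s≤s z≤n) 3≤q)

  dominated-at-zero : ∀ {d e j} → j ≤ d → d ≤ e →
    2 * (q ^ (suc j C 2) * qBinom q (suc d) (d ∸ j)) < q ^ suc e * (q ^ (j C 2) * qBinom q d (d ∸ j))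
  dominated-at-zero {d} {e} {j} j≤d d≤e = begin-strict
      2 * (q ^ (suc j C 2) * Y)   ≡⟨ cong (λ w → 2 * (w * Y)) split ⟩
      2 * (q ^ j * R * Y)         ≡⟨ shuffle (q ^ j) R Y ⟩
      R * (2 * (q ^ j * Y))       <⟨ *-monoʳ-< R {{m^n≢0 q (j C 2)}}
                                       (dominance-base 3≤q (m^n>0 q j) (qBinom-pos q (m∸n≤m d j)) (qBinom-absorb′ q j≤d)) ⟩
      R * (q ^ suc d * X)         ≤⟨ *-monoʳ-≤ R (*-monoˡ-≤ X (^-monoʳ-≤ q (s≤s d≤e))) ⟩
      R * (q ^ suc e * X)         ≡⟨ swap R (q ^ suc e) X ⟩
      q ^ suc e * (R * X)         ∎
    where
    open ≤-Reasoning
    R = q ^ (j C 2)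
    X = qBinom q d (d ∸ j)
    Y = qBinom q (suc d) (d ∸ j)
    split : q ^ (suc j C 2) ≡ q ^ j * R
    split = trans (cong (q ^_) (trans (sym (nCk+nC[k+1]≡[n+1]C[k+1] j 1)) (cong (_+ j C 2) (nC1≡n j))))
                  (^-distribˡ-+-* q j (j C 2))
    shuffle : ∀ T R Y → 2 * (T * R * Y) ≡ R * (2 * (T * Y))
    shuffle = solve-∀
    swap : ∀ R E X → R * (E * X) ≡ E * (R * X)
    swap = solve-∀

  record Shape (d e j m : ℕ) : Set where
    field
      -- j ∸ m truncates to 0 for m ≥ j, where K is positive
      signed    : K q d e j m ≡ sgn (j ∸ m) ℤ.* + ∣ K q d e j m ∣
      nonzero   : 0 < ∣ K q d e j m ∣
      dominated : m ≤ j → 2 * ∣ K q (suc d) (suc e) (suc j) m ∣ < q ^ (m + suc e) * ∣ K q d e j m ∣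

  open Shape

  K-suc-below : ∀ {d e j m} → Shape (suc d) (suc e) (suc j) m → Shape d e j m → m ≤ j →
    K q (suc d) (suc e) (suc j) (suc m)
      ≡ sgn (j ∸ m) ℤ.* + (q ^ (m + suc e) * ∣ K q d e j m ∣ ∸ ∣ K q (suc d) (suc e) (suc j) m ∣)
  K-suc-below {d} {e} {j} {m} upper lower m≤j =
    trans (K-suc q d e j m)
          (sgn-combine-opposite (j ∸ m) (q ^ (m + suc e)) upper-signed (signed lower)
                                (≤-trans (m≤m+n _ _) (<⇒≤ (dominated lower m≤j))))
    where
    upper-signed : K q (suc d) (suc e) (suc j) m ≡ sgn (suc (j ∸ m)) ℤ.* + ∣ K q (suc d) (suc e) (suc j) m ∣
    upper-signed = trans (signed upper) (cong (λ k → sgn k ℤ.* + ∣ K q (suc d) (suc e) (suc j) m ∣) (+-∸-assoc 1 m≤j))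

  K-suc-above : ∀ {d e j m} → Shape (suc d) (suc e) (suc j) m → Shape d e j m → j < m →
    K q (suc d) (suc e) (suc j) (suc m)
      ≡ sgn (j ∸ m) ℤ.* + (∣ K q (suc d) (suc e) (suc j) m ∣ + q ^ (m + suc e) * ∣ K q d e j m ∣)
  K-suc-above {d} {e} {j} {m} upper lower j<m =
    trans (K-suc q d e j m) (sgn-combine-same (j ∸ m) (q ^ (m + suc e)) upper-signed (signed lower))
    where
    upper-signed : K q (suc d) (suc e) (suc j) m ≡ sgn (j ∸ m) ℤ.* + ∣ K q (suc d) (suc e) (suc j) m ∣
    upper-signed = trans (signed upper)
      (cong (λ k → sgn k ℤ.* + ∣ K q (suc d) (suc e) (suc j) m ∣)
            (trans (m≤n⇒m∸n≡0 j<m) (sym (m≤n⇒m∸n≡0 (<⇒≤ j<m)))))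

  shape : ∀ m {d e j} → j ≤ d → d ≤ e → Shape d e j m
  shape zero {d} {e} {j} j≤d d≤e = record
    { signed    = signed-magnitude j _ (K-at-zero q d e j)
    ; nonzero   = subst (0 <_) (sym (∣∣-signed j _ (K-at-zero q d e j)))
                        (*-mono-< (m^n>0 q (j C 2)) (qBinom-pos q (m∸n≤m d j)))
    ; dominated = λ _ → subst₂ (λ a b → 2 * a < q ^ suc e * b)
                               (sym (∣∣-signed (suc j) _ (K-at-zero q (suc d) (suc e) (suc j))))
                               (sym (∣∣-signed j _ (K-at-zero q d e j)))
                               (dominated-at-zero j≤d d≤e)
    }
  shape (suc m) {d} {e} {zero} _ _ = record
    { signed    = signed-magnitude 0 1 (K-zero-rank q d e (suc m))
    ; nonzero   = subst (0 <_) (sym (cong ∣_∣ (K-zero-rank q d e (suc m)))) z<s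
    ; dominated = λ ()
    }
  shape (suc m) {suc d} {suc e} {suc j} (s≤s j≤d) (s≤s d≤e) with m ≤? j
  ... | yes m≤j = record
    { signed    = signed-magnitude (j ∸ m) _ next
    ; nonzero   = subst (0 <_) (sym (∣∣-signed (j ∸ m) _ next)) (≤-<-trans z≤n (2*m<n⇒m<n∸m {a} a-dominated))
    ; dominated = λ _ → subst₂ (λ u v → 2 * u < q * q ^ (m + suc (suc e)) * v)
                                (sym (∣∣-signed (suc j ∸ m) _ (K-suc-below upper′ upper (m≤n⇒m≤1+n m≤j))))
                                (sym (∣∣-signed (j ∸ m) _ next))
                                (dominance-step {a = a′} {b = a} {c = q ^ (m + suc e) * b}
                                                (≤-trans (n≤1+n 2) 3≤q) (m^n>0 q (m + suc (suc e))) a-dominated)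
    }
    where
    upper′ : Shape (suc (suc d)) (suc (suc e)) (suc (suc j)) m
    upper′ = shape m (s≤s (s≤s j≤d)) (s≤s (s≤s d≤e))
    upper : Shape (suc d) (suc e) (suc j) m
    upper = shape m (s≤s j≤d) (s≤s d≤e)
    lower : Shape d e j m
    lower = shape m j≤d d≤e
    a′ = ∣ K q (suc (suc d)) (suc (suc e)) (suc (suc j)) m ∣
    a  = ∣ K q (suc d) (suc e) (suc j) m ∣
    b  = ∣ K q d e j m ∣
    a-dominated : 2 * a < q ^ (m + suc e) * b
    a-dominated = dominated lower m≤j
    next : K q (suc d) (suc e) (suc j) (suc m) ≡ sgn (j ∸ m) ℤ.* + (q ^ (m + suc e) * b ∸ a)
    next = K-suc-below upper lower m≤j
  ... | no m≰j = record
    { signed    = signed-magnitude (j ∸ m) _ next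
    ; nonzero   = subst (0 <_) (sym (∣∣-signed (j ∸ m) _ next)) (<-≤-trans (nonzero upper) (m≤m+n _ _))
    ; dominated = λ { (s≤s m≤j) → contradiction m≤j m≰j }
    }
    where
    upper : Shape (suc d) (suc e) (suc j) m
    upper = shape m (s≤s j≤d) (s≤s d≤e)
    next : K q (suc d) (suc e) (suc j) (suc m)
         ≡ sgn (j ∸ m) ℤ.* + (∣ K q (suc d) (suc e) (suc j) m ∣ + q ^ (m + suc e) * ∣ K q d e j m ∣)
    next = K-suc-above upper (shape m j≤d d≤e) (≰⇒> m≰j)

  K-increasing : ∀ m {d e j} → j ≤ d → d ≤ e →
                 ∣ K q (suc d) (suc e) (suc j) m ∣ < ∣ K q (suc d) (suc e) (suc j) (suc m) ∣
  K-increasing m {d} {e} {j} j≤d d≤e with m ≤? j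
  ... | yes m≤j = subst (a <_) (sym (∣∣-signed (j ∸ m) _ (K-suc-below upper lower m≤j)))
                        (2*m<n⇒m<n∸m (dominated lower m≤j))
    where
    upper : Shape (suc d) (suc e) (suc j) m
    upper = shape m (s≤s j≤d) (s≤s d≤e)
    lower : Shape d e j m
    lower = shape m j≤d d≤e
    a = ∣ K q (suc d) (suc e) (suc j) m ∣
  ... | no m≰j = subst (a <_) (sym (∣∣-signed (j ∸ m) _ (K-suc-above upper lower (≰⇒> m≰j))))
                       (m<m+n a (*-mono-< (m^n>0 q (m + suc e)) (nonzero lower)))
    where
    upper : Shape (suc d) (suc e) (suc j) m
    upper = shape m (s≤s j≤d) (s≤s d≤e)
    lower : Shape d e j m
    lower = shape m j≤d d≤e
    a = ∣ K q (suc d) (suc e) (suc j) m ∣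

theorem4p3 : (q d e : ℕ) → IsPrimePower q → 3 ≤ q → 1 ≤ d → d ≤ e →
    (i j : ℕ) → i < d → 1 ≤ j → j ≤ d →
    ∣ B q d e j i ∣ > ∣ B q d e j (suc i) ∣
theorem4p3 q (suc d) (suc e) _ 3≤q _ (s≤s d≤e) i (suc j) (s≤s i≤d) _ (s≤s j≤d) =
  subst₂ _<_ (cong ∣_∣ (sym (B≡K 1<q (suc d) (suc e) (suc j) (suc i))))
             (cong ∣_∣ (sym (trans (B≡K 1<q (suc d) (suc e) (suc j) i)
                                   (cong (K q (suc d) (suc e) (suc j)) (+-∸-assoc 1 i≤d)))))
             (K-increasing 3≤q (d ∸ i) j≤d d≤e)
  where
  1<q : 1 < q
  1<q = ≤-trans (s≤s (s≤s z≤n)) 3≤q
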